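{- Let $a,h,d,k$ be positive integers with $\gcd(a,d)=1$, $a>2$, $d>h$, $1\leq 2k\leq a-1$, and let $A=(a,\ ha+d,\ ha+2d,\ ha+4d,\ \dots,\ ha+2kd)$. Write $a-1=2ks+t$ with $1\leq t\leq 2k$, and let $f(x)=\sum_{r=0}^{a-1}x^{N_r}$. Then $$f(x)=1+\frac{x^{ha+d}(1-x^{(ha+2kd)(s+1)})}{1-x^{ha+2kd}}+\frac{x^{ha+2d}(1-x^{(ha+2kd)s})(1-x^{2dk})}{(1-x^{ha+2kd})(1-x^{2d})}+\frac{x^{2ha+3d}(1-x^{(ha+2kd)s})(1-x^{2d(k-1)})}{(1-x^{ha+2kd})(1-x^{2d})}+f_1(x),$$ where $$f_1(x)=\begin{cases}\dfrac{x^{ha(s+1)+d(2ks+2)}(1-x^{d(t-1)})}{1-x^{2d}}+\dfrac{x^{ha(s+2)+d(2ks+3)}(1-x^{d(t-1)})}{1-x^{2d}} & \text{if } t \text{ is odd},\\[8pt] \dfrac{x^{ha(s+1)+d(2ks+2)}(1-x^{dt})}{1-x^{2d}}+\dfrac{x^{ha(s+2)+d(2ks+3)}(1-x^{d(t-2)})}{1-x^{2d}} & \text{if } t \text{ is even}.\end{cases}$$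
   Context: For $A=(a,b_1,\dots,b_k)$ with $\gcd(A)=1$ and $0\le r\le a-1$, $N_r=\min\{a_0\in\mathbb{N} : a_0\equiv r \pmod a,\ a_0=\sum_{i}b_ix_i \text{ for some } x_i\in\mathbb{N}\}$ (here $(b_1,\dots,b_k)$ are the entries of $A$ other than the first). -}

module Defs where

open import Data.Nat as ℕ using (ℕ; zero; suc; _+_; _*_; _∸_; _≤_)
open import Data.Nat.DivMod using (_%_)
open import Data.Fin using (Fin; toℕ)
open import Data.Vec using (Vec; zipWith; sum; tabulate)
open import Data.List using (List; foldr; map)
open import Data.Fin using () renaming (zero to fz; suc to fs)
open import Data.List using () renaming (allFin to allFinL)
open import Data.Product using (Σ; _×_)
open import Relation.Binary.PropositionalEquality using (_≡_)
open import Relation.Nullary using (yes; no)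
open import Data.Rational as ℚ using (ℚ; 0ℚ; 1ℚ)
open import Data.Rational.Properties using () renaming (_≟_ to _≟ℚ_)

Representable : ∀ {m} → Vec ℕ m → ℕ → Set
Representable {m} bs n = Σ (Vec ℕ m) λ xs → sum (zipWith _*_ bs xs) ≡ n

CongMod : ℕ → ℕ → ℕ → Set
CongMod a n r = Σ ℕ λ q → n ≡ q * a + r

-- IsN a bs r n : n = N_r for A = (a, b₁, …, b_m), i.e. n is the least
-- a₀ ∈ ℕ with a₀ ≡ r (mod a) and a₀ representable by the b's.
IsN : ∀ {m} → ℕ → Vec ℕ m → ℕ → ℕ → Set
IsN a bs r n =
  CongMod a n r × Representable bs n ×
  (∀ n′ → CongMod a n′ r → Representable bs n′ → n ≤ n′)

gens : (a h d k : ℕ) → Vec ℕ (suc k)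
gens a h d k = tabulate g
  where
  g : Fin (suc k) → ℕ
  g fz     = h * a + d
  g (fs i) = h * a + 2 * (suc (toℕ i)) * d

infixr 8 _^_
_^_ : ℚ → ℕ → ℚ
x ^ zero  = 1ℚ
x ^ suc n = x ℚ.* (x ^ n)

-- total division (p / 0 := 0); only used with nonzero denominators
infixl 7 _÷_
_÷_ : ℚ → ℚ → ℚ
p ÷ q with q ≟ℚ 0ℚ
... | yes _ = 0ℚ
... | no q≢0 = ℚ._÷_ p q {{ℚ.≢-nonZero q≢0}}

fSum : (a : ℕ) → (Fin a → ℕ) → ℚ → ℚ
fSum a N x = foldr ℚ._+_ 0ℚ (map (λ r → x ^ N r) (allFinL a))

f₁ : (a h d k s t : ℕ) → ℚ → ℚ
f₁ a h d k s t x with t % 2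
... | 1 = (x ^ (h * a * (s + 1) + d * (2 * k * s + 2)) ℚ.* (1ℚ ℚ.- x ^ (d * (t ∸ 1))))
            ÷ (1ℚ ℚ.- x ^ (2 * d))
          ℚ.+ (x ^ (h * a * (s + 2) + d * (2 * k * s + 3)) ℚ.* (1ℚ ℚ.- x ^ (d * (t ∸ 1))))
            ÷ (1ℚ ℚ.- x ^ (2 * d))
... | _ = (x ^ (h * a * (s + 1) + d * (2 * k * s + 2)) ℚ.* (1ℚ ℚ.- x ^ (d * t)))
            ÷ (1ℚ ℚ.- x ^ (2 * d))
          ℚ.+ (x ^ (h * a * (s + 2) + d * (2 * k * s + 3)) ℚ.* (1ℚ ℚ.- x ^ (d * (t ∸ 2))))
            ÷ (1ℚ ℚ.- x ^ (2 * d))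

rhs : (a h d k s t : ℕ) → ℚ → ℚ
rhs a h d k s t x =
  1ℚ
  ℚ.+ (x ^ (h * a + d) ℚ.* (1ℚ ℚ.- x ^ (L * (s + 1)))) ÷ (1ℚ ℚ.- x ^ L)
  ℚ.+ (x ^ (h * a + 2 * d) ℚ.* (1ℚ ℚ.- x ^ (L * s)) ℚ.* (1ℚ ℚ.- x ^ (2 * d * k)))
      ÷ ((1ℚ ℚ.- x ^ L) ℚ.* (1ℚ ℚ.- x ^ (2 * d)))
  ℚ.+ (x ^ (2 * h * a + 3 * d) ℚ.* (1ℚ ℚ.- x ^ (L * s)) ℚ.* (1ℚ ℚ.- x ^ (2 * d * (k ∸ 1))))
      ÷ ((1ℚ ℚ.- x ^ L) ℚ.* (1ℚ ℚ.- x ^ (2 * d)))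
  ℚ.+ f₁ a h d k s t x
  where
  L = h * a + 2 * k * d

-- Since gcd(a, d) = 1, c ↦ d·c mod a permutes the residues, and T generators whose weights
-- (in units of d) add up to c sum to T·ha + d·c ≡ d·c (mod a).  Hence N_{d·c mod a} = cost(c)·ha + d·c,
-- where cost(c) is the fewest parts from {1, 2, 4, …, 2k} summing to c: any other representation
-- has weight c′ ≡ c (mod a), so c′ = c or c′ ≥ c + a > c + 2k, and in both cases it uses at least
-- cost(c) generators.  Cutting 1 ≤ c < a into blocks c = 1 + 2kj + i (0 ≤ i < 2k), the exponent is
-- affine in j and ⌊(i - 1)/2⌋ separately for i = 0, i odd and i even, so f is a combination of
-- geometric sums in x^(ha+2kd) and x^(2d); the last, incomplete block of length t gives f₁.
module Submission where

open import Data.Nat using (ℕ)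
open import Data.Rational using (ℚ)

module RationalSums where

  open import Data.Nat as ℕ using (ℕ; zero; suc)
  import Data.Nat.Properties as ℕ
  open import Data.Sum using ([_,_])
  open import Data.Empty using (⊥; ⊥-elim)
  open import Relation.Binary.PropositionalEquality
  open import Relation.Binary.Definitions using (Tri; tri<; tri≈; tri>)
  open import Relation.Nullary using (yes; no)
  open import Data.Rational using (ℚ; 0ℚ; 1ℚ; _+_; _*_; _-_; -_; 1/_; ∣_∣; _≤_; _<_; _>_; NonNegative; ≢-nonZero)
  open import Data.Rational.Properties
  open import Data.Rational.Solver using (module +-*-Solver)
  open +-*-Solver
  open import Algebra.Bundles using (CommutativeRing)
  import Algebra.Properties.CommutativeSemiring.Exp (CommutativeRing.commutativeSemiring +-*-commutativeRing) as Exp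
  open import Defs using (_^_; _÷_; fSum)
  open import Data.Fin using (Fin; toℕ) renaming (zero to fzero; suc to fsuc)
  open import Data.Fin.Permutation using (Permutation; _⟨$⟩ʳ_)
  import Data.List as List
  import Data.List.Properties as List
  open import Function using (id)
  open import Algebra.Properties.CommutativeMonoid.Sum +-0-commutativeMonoid using (sum; sum-cong-≗; ∑-permute)
  open ≡-Reasoning

  ^-≗-Exp : ∀ x n → x ^ n ≡ x Exp.^ n
  ^-≗-Exp x zero    = refl
  ^-≗-Exp x (suc n) = cong (x *_) (^-≗-Exp x n)

  ^-homo-+ : ∀ x m n → x ^ (m ℕ.+ n) ≡ x ^ m * x ^ n
  ^-homo-+ x m n = begin
    x ^ (m ℕ.+ n)         ≡⟨ ^-≗-Exp x (m ℕ.+ n) ⟩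
    x Exp.^ (m ℕ.+ n)     ≡⟨ Exp.^-homo-* x m n ⟩
    x Exp.^ m * x Exp.^ n ≡⟨ sym (cong₂ _*_ (^-≗-Exp x m) (^-≗-Exp x n)) ⟩
    x ^ m * x ^ n         ∎

  ^-* : ∀ x m n → x ^ (m ℕ.* n) ≡ (x ^ m) ^ n
  ^-* x m n = begin
    x ^ (m ℕ.* n)       ≡⟨ ^-≗-Exp x (m ℕ.* n) ⟩
    x Exp.^ (m ℕ.* n)   ≡⟨ sym (Exp.^-assocʳ x m n) ⟩
    (x Exp.^ m) Exp.^ n ≡⟨ sym (trans (^-≗-Exp (x ^ m) n) (cong (Exp._^ n) (^-≗-Exp x m))) ⟩
    (x ^ m) ^ n         ∎

  ∑ : ℕ → (ℕ → ℚ) → ℚ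
  ∑ zero    f = 0ℚ
  ∑ (suc n) f = f 0 + ∑ n (λ i → f (suc i))

  ∑-cong : ∀ n {f g : ℕ → ℚ} → (∀ i → i ℕ.< n → f i ≡ g i) → ∑ n f ≡ ∑ n g
  ∑-cong zero    f≗g = refl
  ∑-cong (suc n) f≗g = cong₂ _+_ (f≗g 0 (ℕ.s≤s ℕ.z≤n)) (∑-cong n (λ i i<n → f≗g (suc i) (ℕ.s≤s i<n)))

  *-distribˡ-∑ : ∀ c n (f : ℕ → ℚ) → c * ∑ n f ≡ ∑ n (λ i → c * f i)
  *-distribˡ-∑ c zero    f = *-zeroʳ c
  *-distribˡ-∑ c (suc n) f = trans (*-distribˡ-+ c _ _) (cong (c * f 0 +_) (*-distribˡ-∑ c n _))

  *-distribʳ-∑ : ∀ c n (f : ℕ → ℚ) → ∑ n f * c ≡ ∑ n (λ i → f i * c)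
  *-distribʳ-∑ c zero    f = *-zeroˡ c
  *-distribʳ-∑ c (suc n) f = trans (*-distribʳ-+ c (f 0) (∑ n (λ i → f (suc i)))) (cong (f 0 * c +_) (*-distribʳ-∑ c n _))

  ∑-+ : ∀ m n (f : ℕ → ℚ) → ∑ (m ℕ.+ n) f ≡ ∑ m f + ∑ n (λ i → f (m ℕ.+ i))
  ∑-+ zero    n f = sym (+-identityˡ _)
  ∑-+ (suc m) n f = trans (cong (f 0 +_) (∑-+ m n (λ i → f (suc i)))) (sym (+-assoc (f 0) _ _))

  ∑-suc : ∀ n (f : ℕ → ℚ) → ∑ (suc n) f ≡ ∑ n f + f n
  ∑-suc n f = begin
    ∑ (suc n) f                 ≡⟨ cong (λ m → ∑ m f) (ℕ.+-comm 1 n) ⟩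
    ∑ (n ℕ.+ 1) f               ≡⟨ ∑-+ n 1 f ⟩
    ∑ n f + (f (n ℕ.+ 0) + 0ℚ)  ≡⟨ cong (∑ n f +_) (trans (+-identityʳ _) (cong f (ℕ.+-identityʳ n))) ⟩
    ∑ n f + f n                 ∎

  ∑-* : ∀ K s (f : ℕ → ℚ) → ∑ (K ℕ.* s) f ≡ ∑ s (λ j → ∑ K (λ i → f (K ℕ.* j ℕ.+ i)))
  ∑-* K zero    f = cong (λ m → ∑ m f) (ℕ.*-zeroʳ K)
  ∑-* K (suc s) f = begin
    ∑ (K ℕ.* suc s) f                               ≡⟨ cong (λ m → ∑ m f) (ℕ.*-suc K s) ⟩
    ∑ (K ℕ.+ K ℕ.* s) f                             ≡⟨ ∑-+ K (K ℕ.* s) f ⟩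
    ∑ K f + ∑ (K ℕ.* s) (λ i → f (K ℕ.+ i))
      ≡⟨ cong₂ _+_ (∑-cong K (λ i _ → cong (λ m → f (m ℕ.+ i)) (sym (ℕ.*-zeroʳ K))))
                   (trans (∑-* K s _) (∑-cong s (λ j _ → ∑-cong K (λ i _ → cong f (shift j i))))) ⟩
    ∑ (suc s) (λ j → ∑ K (λ i → f (K ℕ.* j ℕ.+ i))) ∎
    where
    shift : ∀ j i → K ℕ.+ (K ℕ.* j ℕ.+ i) ≡ K ℕ.* suc j ℕ.+ i
    shift j i = trans (sym (ℕ.+-assoc K _ i)) (cong (ℕ._+ i) (sym (ℕ.*-suc K j)))

  ∑-interleave : ∀ u (f : ℕ → ℚ) → ∑ (2 ℕ.* u) f ≡ ∑ u (λ l → f (2 ℕ.* l)) + ∑ u (λ l → f (suc (2 ℕ.* l)))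
  ∑-interleave zero    f = sym (+-identityˡ 0ℚ)
  ∑-interleave (suc u) f = begin
    ∑ (2 ℕ.* suc u) f                                          ≡⟨ cong (λ m → ∑ m f) (2*suc u) ⟩
    f 0 + (f 1 + ∑ (2 ℕ.* u) (λ i → f (2 ℕ.+ i)))              ≡⟨ cong (λ v → f 0 + (f 1 + v)) (∑-interleave u _) ⟩
    f 0 + (f 1 + (∑ u evens + ∑ u odds))
      ≡⟨ solve 4 (λ a b c d → a :+ (b :+ (c :+ d)) := (a :+ c) :+ (b :+ d)) refl (f 0) (f 1) _ _ ⟩
    (f 0 + ∑ u evens) + (f 1 + ∑ u odds)
      ≡⟨ cong₂ (λ v w → (f 0 + v) + (f 1 + w)) (∑-cong u (λ l _ → cong f (sym (2*suc l))))
                                               (∑-cong u (λ l _ → cong (λ m → f (suc m)) (sym (2*suc l)))) ⟩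
    ∑ (suc u) (λ l → f (2 ℕ.* l)) + ∑ (suc u) (λ l → f (suc (2 ℕ.* l))) ∎
    where
    evens = λ l → f (2 ℕ.+ 2 ℕ.* l)
    odds  = λ l → f (3 ℕ.+ 2 ℕ.* l)
    2*suc : ∀ l → 2 ℕ.* suc l ≡ 2 ℕ.+ 2 ℕ.* l
    2*suc l = ℕ.*-suc 2 l

  geometric : ℚ → ℕ → ℚ
  geometric y n = ∑ n (y ^_)

  geometric-suc : ∀ y n → geometric y (suc n) ≡ geometric y n + y ^ n
  geometric-suc y n = ∑-suc n (y ^_)

  1-y*geometric : ∀ y n → (1ℚ - y) * geometric y n ≡ 1ℚ - y ^ n
  1-y*geometric y zero    = trans (*-zeroʳ (1ℚ - y)) (sym (+-inverseʳ 1ℚ))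
  1-y*geometric y (suc n) = begin
    (1ℚ - y) * (1ℚ + ∑ n (λ i → y * y ^ i)) ≡⟨ cong (λ v → (1ℚ - y) * (1ℚ + v)) (sym (*-distribˡ-∑ y n (y ^_))) ⟩
    (1ℚ - y) * (1ℚ + y * geometric y n)
      ≡⟨ solve 2 (λ y g → (con 1ℚ :- y) :* (con 1ℚ :+ y :* g) := (con 1ℚ :- y) :+ y :* ((con 1ℚ :- y) :* g)) refl y _ ⟩
    (1ℚ - y) + y * ((1ℚ - y) * geometric y n) ≡⟨ cong (λ v → (1ℚ - y) + y * v) (1-y*geometric y n) ⟩
    (1ℚ - y) + y * (1ℚ - y ^ n)
      ≡⟨ solve 2 (λ y p → (con 1ℚ :- y) :+ y :* (con 1ℚ :- p) := con 1ℚ :- y :* p) refl y (y ^ n) ⟩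
    1ℚ - y ^ suc n ∎

  ÷-unique : ∀ {p q v} → q ≢ 0ℚ → p ≡ q * v → p ÷ q ≡ v
  ÷-unique {p} {q} {v} q≢0 p≡qv with q ≟ 0ℚ
  ... | yes q≡0 = ⊥-elim (q≢0 q≡0)
  ... | no  q≢0′ = begin
    p * 1/ q         ≡⟨ cong (_* 1/ q) p≡qv ⟩
    q * v * 1/ q     ≡⟨ solve 3 (λ q v r → q :* v :* r := v :* (q :* r)) refl q v (1/ q) ⟩
    v * (q * 1/ q)   ≡⟨ cong (v *_) (*-inverseʳ q) ⟩
    v * 1ℚ           ≡⟨ *-identityʳ v ⟩
    v                ∎
    where instance _ = ≢-nonZero q≢0′

  *-≢0 : ∀ {p q} → p ≢ 0ℚ → q ≢ 0ℚ → p * q ≢ 0ℚ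
  *-≢0 {p} {q} p≢0 q≢0 pq≡0 = q≢0 (begin
    q                ≡⟨ sym (*-identityˡ q) ⟩
    1ℚ * q           ≡⟨ cong (_* q) (sym (*-inverseˡ p)) ⟩
    1/ p * p * q     ≡⟨ *-assoc (1/ p) p q ⟩
    1/ p * (p * q)   ≡⟨ cong (1/ p *_) pq≡0 ⟩
    1/ p * 0ℚ        ≡⟨ *-zeroʳ (1/ p) ⟩
    0ℚ               ∎)
    where instance _ = ≢-nonZero p≢0

  *[1-y^n]÷[1-y] : ∀ X y n → 1ℚ - y ≢ 0ℚ → (X * (1ℚ - y ^ n)) ÷ (1ℚ - y) ≡ X * geometric y n
  *[1-y^n]÷[1-y] X y n 1-y≢0 = ÷-unique 1-y≢0 (begin
    X * (1ℚ - y ^ n)                   ≡⟨ cong (X *_) (sym (1-y*geometric y n)) ⟩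
    X * ((1ℚ - y) * geometric y n)
      ≡⟨ solve 3 (λ X u g → X :* (u :* g) := u :* (X :* g)) refl X (1ℚ - y) _ ⟩
    (1ℚ - y) * (X * geometric y n)     ∎)

  *[1-y^m][1-z^n]÷[1-y][1-z] : ∀ X y z m n → 1ℚ - y ≢ 0ℚ → 1ℚ - z ≢ 0ℚ →
    (X * (1ℚ - y ^ m) * (1ℚ - z ^ n)) ÷ ((1ℚ - y) * (1ℚ - z)) ≡ X * geometric y m * geometric z n
  *[1-y^m][1-z^n]÷[1-y][1-z] X y z m n 1-y≢0 1-z≢0 = ÷-unique (*-≢0 1-y≢0 1-z≢0) (begin
    X * (1ℚ - y ^ m) * (1ℚ - z ^ n)
      ≡⟨ cong₂ (λ u v → X * u * v) (sym (1-y*geometric y m)) (sym (1-y*geometric z n)) ⟩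
    X * ((1ℚ - y) * geometric y m) * ((1ℚ - z) * geometric z n)
      ≡⟨ solve 5 (λ X u v g h → X :* (u :* g) :* (v :* h) := (u :* v) :* (X :* g :* h))
               refl X (1ℚ - y) (1ℚ - z) (geometric y m) (geometric z n) ⟩
    (1ℚ - y) * (1ℚ - z) * (X * geometric y m * geometric z n) ∎)

  ∣^∣ : ∀ x n → ∣ x ^ n ∣ ≡ ∣ x ∣ ^ n
  ∣^∣ x zero    = refl
  ∣^∣ x (suc n) = trans (∣p*q∣≡∣p∣*∣q∣ x (x ^ n)) (cong (∣ x ∣ *_) (∣^∣ x n))

  module _ (y : ℚ) .{{_ : NonNegative y}} where

    ^≤1 : y ≤ 1ℚ → ∀ n → y ^ n ≤ 1ℚ
    ^≤1 y≤1 zero    = ≤-refl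
    ^≤1 y≤1 (suc n) = ≤-trans (*-monoˡ-≤-nonNeg y (^≤1 y≤1 n)) (≤-trans (≤-reflexive (*-identityʳ y)) y≤1)

    ^-suc≤ : y ≤ 1ℚ → ∀ n → y ^ suc n ≤ y
    ^-suc≤ y≤1 n = ≤-trans (*-monoˡ-≤-nonNeg y (^≤1 y≤1 n)) (≤-reflexive (*-identityʳ y))

    1≤^ : 1ℚ ≤ y → ∀ n → 1ℚ ≤ y ^ n
    1≤^ 1≤y zero    = ≤-refl
    1≤^ 1≤y (suc n) = ≤-trans (≤-trans 1≤y (≤-reflexive (sym (*-identityʳ y)))) (*-monoˡ-≤-nonNeg y (1≤^ 1≤y n))

    ≤^-suc : 1ℚ ≤ y → ∀ n → y ≤ y ^ suc n
    ≤^-suc 1≤y n = ≤-trans (≤-reflexive (sym (*-identityʳ y))) (*-monoˡ-≤-nonNeg y (1≤^ 1≤y n))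

  ^-suc≡1⇒∣x∣≡1 : ∀ x m → x ^ suc m ≡ 1ℚ → ∣ x ∣ ≡ 1ℚ
  ^-suc≡1⇒∣x∣≡1 x m x^n≡1 = compare (<-cmp ∣ x ∣ 1ℚ)
    where
    instance _ = ∣-∣-nonNeg x
    ∣x∣^n≡1 : ∣ x ∣ ^ suc m ≡ 1ℚ
    ∣x∣^n≡1 = trans (sym (∣^∣ x (suc m))) (cong ∣_∣ x^n≡1)
    compare : Tri (∣ x ∣ < 1ℚ) (∣ x ∣ ≡ 1ℚ) (∣ x ∣ > 1ℚ) → ∣ x ∣ ≡ 1ℚ
    compare (tri< ∣x∣<1 _ _) = ⊥-elim (<-irrefl ∣x∣^n≡1 (≤-<-trans (^-suc≤ ∣ x ∣ (<⇒≤ ∣x∣<1) m) ∣x∣<1))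
    compare (tri≈ _ ∣x∣≡1 _) = ∣x∣≡1
    compare (tri> _ _ 1<∣x∣) = ⊥-elim (<-irrefl (sym ∣x∣^n≡1) (<-≤-trans 1<∣x∣ (≤^-suc ∣ x ∣ (<⇒≤ 1<∣x∣) m)))

  1-p≡0⇒p≡1 : ∀ {p} → 1ℚ - p ≡ 0ℚ → p ≡ 1ℚ
  1-p≡0⇒p≡1 {p} 1-p≡0 = begin
    p               ≡⟨ solve 1 (λ p → p := con 1ℚ :- (con 1ℚ :- p)) refl p ⟩
    1ℚ - (1ℚ - p)   ≡⟨ cong (λ q → 1ℚ - q) 1-p≡0 ⟩
    1ℚ - 0ℚ         ≡⟨ +-identityʳ 1ℚ ⟩
    1ℚ              ∎

  1-^≢0 : ∀ {x} n → x ≢ 1ℚ → x ≢ - 1ℚ → 1 ℕ.≤ n → 1ℚ - x ^ n ≢ 0ℚ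
  1-^≢0 {x} (suc m) x≢1 x≢-1 _ 1-x^n≡0 = [ ∣x∣≡x⇒⊥ , ∣x∣≡-x⇒⊥ ] (∣p∣≡p∨∣p∣≡-p x)
    where
    ∣x∣≡1 : ∣ x ∣ ≡ 1ℚ
    ∣x∣≡1 = ^-suc≡1⇒∣x∣≡1 x m (1-p≡0⇒p≡1 1-x^n≡0)
    ∣x∣≡x⇒⊥ : ∣ x ∣ ≡ x → ⊥
    ∣x∣≡x⇒⊥ ∣x∣≡x = x≢1 (trans (sym ∣x∣≡x) ∣x∣≡1)
    ∣x∣≡-x⇒⊥ : ∣ x ∣ ≡ - x → ⊥
    ∣x∣≡-x⇒⊥ ∣x∣≡-x = x≢-1 (trans (solve 1 (λ x → x := :- (:- x)) refl x) (cong -_ (trans (sym ∣x∣≡-x) ∣x∣≡1)))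

  private
    foldr-tabulate : ∀ n (f : Fin n → ℚ) → List.foldr _+_ 0ℚ (List.tabulate f) ≡ sum f
    foldr-tabulate zero    f = refl
    foldr-tabulate (suc n) f = cong (f fzero +_) (foldr-tabulate n (λ i → f (fsuc i)))

    sum≡∑ : ∀ n (f : ℕ → ℚ) → sum (λ (i : Fin n) → f (toℕ i)) ≡ ∑ n f
    sum≡∑ zero    f = refl
    sum≡∑ (suc n) f = cong (f 0 +_) (sum≡∑ n (λ i → f (suc i)))

  fSum-permute : ∀ {a} (π : Permutation a a) (N : Fin a → ℕ) (n : ℕ → ℕ) x →
    (∀ c → N (π ⟨$⟩ʳ c) ≡ n (toℕ c)) → fSum a N x ≡ ∑ a (λ c → x ^ n c)
  fSum-permute {a} π N n x N∘π≗n = begin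
    List.foldr _+_ 0ℚ (List.map (λ r → x ^ N r) (List.allFin a))  ≡⟨ cong (List.foldr _+_ 0ℚ) (List.map-tabulate id (λ r → x ^ N r)) ⟩
    List.foldr _+_ 0ℚ (List.tabulate (λ r → x ^ N r))             ≡⟨ foldr-tabulate a (λ r → x ^ N r) ⟩
    sum {a} (λ r → x ^ N r)                                      ≡⟨ ∑-permute (λ r → x ^ N r) π ⟩
    sum {a} (λ c → x ^ N (π ⟨$⟩ʳ c))                              ≡⟨ sum-cong-≗ (λ c → cong (x ^_) (N∘π≗n c)) ⟩
    sum {a} (λ c → x ^ n (toℕ c))                                ≡⟨ sum≡∑ a (λ c → x ^ n c) ⟩
    ∑ a (λ c → x ^ n c)                                          ∎

module NumericalSemigroups where

  open import Data.Nat
  open import Data.Nat.Properties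
  open import Data.Nat.DivMod
  open import Data.Nat.Divisibility using (n∣m*n)
  open import Data.Nat.Tactic.RingSolver using (solve-∀)
  open import Data.Nat.GCD using (gcd; module Bézout)
  open import Data.Nat.Coprimality using (coprime-Bézout; gcd≡1⇒coprime)
  open import Data.Fin using (Fin; toℕ; fromℕ<) renaming (zero to fzero; suc to fsuc)
  open import Data.Fin.Properties using (toℕ-fromℕ<; toℕ<n; toℕ-injective)
  open import Data.Fin.Permutation using (Permutation; permutation; _⟨$⟩ʳ_)
  open import Data.Vec using (Vec; []; _∷_; zipWith; sum; lookup; replicate; tabulate)
  open import Data.Vec.Properties using (lookup∘tabulate)
  open import Data.Sum using (_⊎_; inj₁; inj₂)
  open import Data.Product using (∃; ∃₂; _×_; _,_; proj₁; proj₂)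
  open import Relation.Binary.PropositionalEquality
  open import Relation.Nullary using (contradiction)
  open import Defs using (Representable; CongMod; IsN; gens)

  [r+j*n]/n≡j : ∀ {r} j n .{{_ : NonZero n}} → r < n → (r + j * n) / n ≡ j
  [r+j*n]/n≡j {r} j n r<n = begin
    (r + j * n) / n    ≡⟨ +-distrib-/-∣ʳ r (n∣m*n j) ⟩
    r / n + j * n / n  ≡⟨ cong₂ _+_ (m<n⇒m/n≡0 r<n) (m*n/n≡m j n) ⟩
    j                  ∎
    where open ≡-Reasoning

  [r+j*n]%n≡r : ∀ {r} j n .{{_ : NonZero n}} → r < n → (r + j * n) % n ≡ r
  [r+j*n]%n≡r j n r<n = trans ([m+kn]%n≡m%n _ j n) (m<n⇒m%n≡m r<n)

  odd⊎even : ∀ {t} → 1 ≤ t → (∃ λ u → t ≡ suc (2 * u)) ⊎ (∃ λ u → t ≡ 2 * suc u)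
  odd⊎even {t} 1≤t with t divMod 2
  ... | result zero    fzero        refl = contradiction 1≤t λ ()
  ... | result (suc u) fzero        refl = inj₂ (u , *-comm (suc u) 2)
  ... | result u       (fsuc fzero) refl = inj₁ (u , cong suc (*-comm u 2))

  ≡-mod⇒≡⊎+≤ : ∀ {a c c′} .{{_ : NonZero a}} → c < a → c′ % a ≡ c → c′ ≡ c ⊎ c + a ≤ c′
  ≡-mod⇒≡⊎+≤ {a} {c} {c′} c<a c′%a≡c with c′ / a | trans (m≡m%n+[m/n]*n c′ a) (cong (λ r → r + (c′ / a) * a) c′%a≡c)
  ... | zero  | c′≡c+0   = inj₁ (trans c′≡c+0 (+-identityʳ c))
  ... | suc q | c′≡c+q*a = inj₂ (≤-trans (+-monoʳ-≤ c (m≤m+n a (q * a))) (≤-reflexive (sym c′≡c+q*a)))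

  %-congʳ-* : ∀ m n a .{{_ : NonZero a}} → (m * (n % a)) % a ≡ (m * n) % a
  %-congʳ-* m n a = begin
    (m * (n % a)) % a             ≡⟨ %-distribˡ-* m (n % a) a ⟩
    ((m % a) * (n % a % a)) % a   ≡⟨ cong (λ v → ((m % a) * v) % a) (m%n%n≡m%n n a) ⟩
    ((m % a) * (n % a)) % a       ≡⟨ %-distribˡ-* m n a ⟨
    (m * n) % a                   ∎
    where open ≡-Reasoning

  inverse-mod : ∀ a d → gcd (2 + a) d ≡ 1 → ∃ λ e → (d * e) % (2 + a) ≡ 1
  inverse-mod a d gcd≡1 with coprime-Bézout (gcd≡1⇒coprime gcd≡1)
  ... | Bézout.-+ x y 1+x[2+a]≡yd = y , (begin
    (d * y) % (2 + a)               ≡⟨ cong (_% (2 + a)) (trans (*-comm d y) (sym 1+x[2+a]≡yd)) ⟩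
    (1 + x * (2 + a)) % (2 + a)     ≡⟨ [m+kn]%n≡m%n 1 x (2 + a) ⟩
    1                               ∎)
    where open ≡-Reasoning
  ... | Bézout.+- x y 1+yd≡x[2+a] = y * (1 + a) , (begin
    (d * (y * (1 + a))) % (2 + a)                    ≡⟨ [m+kn]%n≡m%n (d * (y * (1 + a))) x (2 + a) ⟨
    (d * (y * (1 + a)) + x * (2 + a)) % (2 + a)      ≡⟨ cong (λ v → (d * (y * (1 + a)) + v) % (2 + a)) (sym 1+yd≡x[2+a]) ⟩
    (d * (y * (1 + a)) + (1 + y * d)) % (2 + a)      ≡⟨ cong (_% (2 + a)) (regroup a d y) ⟩
    (1 + (d * y) * (2 + a)) % (2 + a)                ≡⟨ [m+kn]%n≡m%n 1 (d * y) (2 + a) ⟩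
    1                                                ∎)
    where
    open ≡-Reasoning
    regroup : ∀ a d y → d * (y * (1 + a)) + (1 + y * d) ≡ 1 + (d * y) * (2 + a)
    regroup = solve-∀

  module MultiplicationMod (a : ℕ) .{{_ : NonZero a}} {d e : ℕ} (de≡1 : (d * e) % a ≡ 1) where

    e*[d*u]%a≡u%a : ∀ u → (e * (d * u)) % a ≡ u % a
    e*[d*u]%a≡u%a u = begin
      (e * (d * u)) % a               ≡⟨ cong (_% a) (trans (sym (*-assoc e d u)) (cong (_* u) (*-comm e d))) ⟩
      (d * e * u) % a                 ≡⟨ %-distribˡ-* (d * e) u a ⟩
      ((d * e) % a * (u % a)) % a     ≡⟨ cong (λ v → (v * (u % a)) % a) de≡1 ⟩
      (1 * (u % a)) % a               ≡⟨ cong (_% a) (*-identityˡ (u % a)) ⟩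
      u % a % a                       ≡⟨ m%n%n≡m%n u a ⟩
      u % a                           ∎
      where open ≡-Reasoning

    d*[e*u]%a≡u%a : ∀ u → (d * (e * u)) % a ≡ u % a
    d*[e*u]%a≡u%a u = trans (cong (_% a) (swap d e u)) (e*[d*u]%a≡u%a u)
      where
      swap : ∀ d e u → d * (e * u) ≡ e * (d * u)
      swap = solve-∀

    *-cancelˡ-≡-mod : ∀ u v → (d * u) % a ≡ (d * v) % a → u % a ≡ v % a
    *-cancelˡ-≡-mod u v du≡dv = begin
      u % a                   ≡⟨ e*[d*u]%a≡u%a u ⟨
      (e * (d * u)) % a       ≡⟨ %-congʳ-* e (d * u) a ⟨
      (e * ((d * u) % a)) % a ≡⟨ cong (λ w → (e * w) % a) du≡dv ⟩
      (e * ((d * v) % a)) % a ≡⟨ %-congʳ-* e (d * v) a ⟩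
      (e * (d * v)) % a       ≡⟨ e*[d*u]%a≡u%a v ⟩
      v % a                   ∎
      where open ≡-Reasoning

    private
      mulMod : ℕ → Fin a → Fin a
      mulMod m r = fromℕ< (m%n<n (m * toℕ r) a)

      toℕ-mulMod : ∀ m r → toℕ (mulMod m r) ≡ (m * toℕ r) % a
      toℕ-mulMod m r = toℕ-fromℕ< (m%n<n (m * toℕ r) a)

      mulMod-inverse : ∀ m m′ → (∀ u → (m * (m′ * u)) % a ≡ u % a) → ∀ r → mulMod m (mulMod m′ r) ≡ r
      mulMod-inverse m m′ inv r = toℕ-injective (begin
        toℕ (mulMod m (mulMod m′ r))       ≡⟨ toℕ-mulMod m (mulMod m′ r) ⟩
        (m * toℕ (mulMod m′ r)) % a        ≡⟨ cong (λ v → (m * v) % a) (toℕ-mulMod m′ r) ⟩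
        (m * ((m′ * toℕ r) % a)) % a       ≡⟨ %-congʳ-* m (m′ * toℕ r) a ⟩
        (m * (m′ * toℕ r)) % a             ≡⟨ inv (toℕ r) ⟩
        toℕ r % a                          ≡⟨ m<n⇒m%n≡m (toℕ<n r) ⟩
        toℕ r                              ∎)
        where open ≡-Reasoning

    multiplication : Permutation a a
    multiplication = permutation (mulMod d) (mulMod e)
      (mulMod-inverse d e d*[e*u]%a≡u%a) (mulMod-inverse e d e*[d*u]%a≡u%a)

    toℕ-multiplication : ∀ c → toℕ (multiplication ⟨$⟩ʳ c) ≡ (d * toℕ c) % a
    toℕ-multiplication = toℕ-mulMod d

  dot : ∀ {m} → Vec ℕ m → Vec ℕ m → ℕ
  dot bs xs = sum (zipWith _*_ bs xs)

  dot-zeroʳ : ∀ {m} (bs : Vec ℕ m) → dot bs (replicate m 0) ≡ 0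
  dot-zeroʳ []       = refl
  dot-zeroʳ (b ∷ bs) = cong₂ _+_ (*-zeroʳ b) (dot-zeroʳ bs)

  dot-distribʳ-+ : ∀ {m} (bs xs ys : Vec ℕ m) → dot bs (zipWith _+_ xs ys) ≡ dot bs xs + dot bs ys
  dot-distribʳ-+ []       []       []       = refl
  dot-distribʳ-+ (b ∷ bs) (x ∷ xs) (y ∷ ys) = begin
    b * (x + y) + dot bs (zipWith _+_ xs ys) ≡⟨ cong (b * (x + y) +_) (dot-distribʳ-+ bs xs ys) ⟩
    b * (x + y) + (dot bs xs + dot bs ys)    ≡⟨ interchange b x y (dot bs xs) (dot bs ys) ⟩
    (b * x + dot bs xs) + (b * y + dot bs ys) ∎
    where
    open ≡-Reasoning
    interchange : ∀ b x y u v → b * (x + y) + (u + v) ≡ (b * x + u) + (b * y + v)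
    interchange = solve-∀

  basis : ∀ {m} → Fin m → Vec ℕ m
  basis {suc m} fzero    = 1 ∷ replicate m 0
  basis {suc m} (fsuc i) = 0 ∷ basis i

  dot-basis : ∀ {m} (bs : Vec ℕ m) i → dot bs (basis i) ≡ lookup bs i
  dot-basis (b ∷ bs) fzero    = trans (cong₂ _+_ (*-identityʳ b) (dot-zeroʳ bs)) (+-identityʳ b)
  dot-basis (b ∷ bs) (fsuc i) = trans (cong (_+ dot bs (basis i)) (*-zeroʳ b)) (dot-basis bs i)

  module _ {m} (bs : Vec ℕ m) where

    representable-0 : Representable bs 0
    representable-0 = replicate m 0 , dot-zeroʳ bs

    representable-+ : ∀ {n n′} → Representable bs n → Representable bs n′ → Representable bs (n + n′)
    representable-+ (xs , refl) (ys , refl) = zipWith _+_ xs ys , dot-distribʳ-+ bs xs ys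

    representable-lookup : ∀ i → Representable bs (lookup bs i)
    representable-lookup i = basis i , dot-basis bs i

    representable-* : ∀ j {n} → Representable bs n → Representable bs (j * n)
    representable-* zero    _   = representable-0
    representable-* (suc j) rep = representable-+ rep (representable-* j rep)

  tabulate-shape : ∀ H d B {m} (w : Fin m → ℕ) → (∀ i → w i ≤ B) → (ys : Vec ℕ m) →
    ∃₂ λ T W → W ≤ B * T × dot (tabulate (λ i → H + 2 * w i * d)) ys ≡ T * H + d * (2 * W)
  tabulate-shape H d B w w≤B []       = 0 , 0 , z≤n , sym (*-zeroʳ d)
  tabulate-shape H d B w w≤B (y ∷ ys) with tabulate-shape H d B (λ i → w (fsuc i)) (λ i → w≤B (fsuc i)) ys
  ... | T , W , W≤BT , dot≡ = y + T , w fzero * y + W ,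
        ≤-trans (+-mono-≤ (*-monoˡ-≤ y (w≤B fzero)) W≤BT) (≤-reflexive (sym (*-distribˡ-+ B y T))) ,
        trans (cong ((H + 2 * w fzero * d) * y +_) dot≡) (regroup H d (w fzero) y T W)
    where
    regroup : ∀ H d w y T W → (H + 2 * w * d) * y + (T * H + d * (2 * W)) ≡ (y + T) * H + d * (2 * (w * y + W))
    regroup = solve-∀

  IsN-unique : ∀ {m a} {bs : Vec ℕ m} {r n n′} → IsN a bs r n → IsN a bs r n′ → n ≡ n′
  IsN-unique (≡r , rep , least) (≡r′ , rep′ , least′) = ≤-antisym (least _ ≡r′ rep′) (least′ _ ≡r rep)

  module Cost (k′ : ℕ) where

    k : ℕ
    k = suc k′

    ⌈_/k⌉ : ℕ → ℕ
    ⌈ q /k⌉ = (q + k′) / k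

    ⌈/k⌉-≤ : ∀ {q n} → q ≤ k * n → ⌈ q /k⌉ ≤ n
    ⌈/k⌉-≤ {q} {n} q≤kn = s≤s⁻¹ (m<n*o⇒m/o<n (begin-strict
      q + k′          ≤⟨ +-monoˡ-≤ k′ q≤kn ⟩
      k * n + k′      <⟨ +-monoʳ-< (k * n) (n<1+n k′) ⟩
      k * n + k       ≡⟨ trans (+-comm (k * n) k) (cong (k +_) (*-comm k n)) ⟩
      suc n * k       ∎))
      where open ≤-Reasoning

    ⌈j*k/k⌉ : ∀ j → ⌈ j * k /k⌉ ≡ j
    ⌈j*k/k⌉ j = trans (cong (_/ k) (+-comm (j * k) k′)) ([r+j*n]/n≡j j k (n<1+n k′))

    ⌈1+r+j*k/k⌉ : ∀ {r} j → r < k → ⌈ suc (r + j * k) /k⌉ ≡ suc j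
    ⌈1+r+j*k/k⌉ {r} j r<k = trans (cong (_/ k) (rearrange r k′ j)) ([r+j*n]/n≡j (suc j) k r<k)
      where
      rearrange : ∀ r k′ j → suc (r + j * suc k′) + k′ ≡ r + suc j * suc k′
      rearrange = solve-∀

    -- The fewest parts from {1, 2, 4, …, 2k} with sum c: one part 1 if c is odd, the rest as large as possible.
    cost : ℕ → ℕ
    cost c = c % 2 + ⌈ c / 2 /k⌉

    cost-parity : ∀ {e} q → e < 2 → cost (e + q * 2) ≡ e + ⌈ q /k⌉
    cost-parity q e<2 = cong₂ (λ e′ q′ → e′ + ⌈ q′ /k⌉) ([r+j*n]%n≡r q 2 e<2) ([r+j*n]/n≡j q 2 e<2)

    cost-≤ : ∀ x₀ {T W} → W ≤ k * T → cost (x₀ + 2 * W) ≤ x₀ + T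
    cost-≤ x₀ {T} {W} W≤kT = begin
      cost (x₀ + 2 * W)                   ≡⟨ cong cost split ⟩
      cost (x₀ % 2 + (x₀ / 2 + W) * 2)    ≡⟨ cost-parity (x₀ / 2 + W) (m%n<n x₀ 2) ⟩
      x₀ % 2 + ⌈ x₀ / 2 + W /k⌉           ≤⟨ +-monoʳ-≤ (x₀ % 2) (⌈/k⌉-≤ (≤-trans (+-mono-≤ (m≤m+n (x₀ / 2) _) W≤kT)
                                            (≤-reflexive (sym (*-distribˡ-+ k (x₀ / 2) T))))) ⟩
      x₀ % 2 + (x₀ / 2 + T)               ≤⟨ ≤-reflexive (sym (+-assoc (x₀ % 2) _ T)) ⟩
      x₀ % 2 + x₀ / 2 + T                 ≤⟨ +-monoˡ-≤ T (≤-trans (+-monoʳ-≤ (x₀ % 2) (m≤m*n (x₀ / 2) 2))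
                                                            (≤-reflexive (sym (m≡m%n+[m/n]*n x₀ 2)))) ⟩
      x₀ + T                              ∎
      where
      open ≤-Reasoning
      split : x₀ + 2 * W ≡ x₀ % 2 + (x₀ / 2 + W) * 2
      split = begin-equality
        x₀ + 2 * W                         ≡⟨ cong (_+ 2 * W) (m≡m%n+[m/n]*n x₀ 2) ⟩
        x₀ % 2 + x₀ / 2 * 2 + 2 * W        ≡⟨ regroup (x₀ % 2) (x₀ / 2) W ⟩
        x₀ % 2 + (x₀ / 2 + W) * 2          ∎
        where
        regroup : ∀ e u W → e + u * 2 + 2 * W ≡ e + (u + W) * 2
        regroup = solve-∀

    cost-≤-suc : ∀ {c} n → c ≤ 2 * k * n → cost c ≤ suc n
    cost-≤-suc {c} n c≤2kn = +-mono-≤ (s≤s⁻¹ (m%n<n c 2)) (⌈/k⌉-≤ (begin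
      c / 2               ≤⟨ /-monoˡ-≤ 2 c≤2kn ⟩
      2 * k * n / 2       ≡⟨ cong (_/ 2) (trans (*-assoc 2 k n) (*-comm 2 (k * n))) ⟩
      k * n * 2 / 2       ≡⟨ m*n/n≡m (k * n) 2 ⟩
      k * n               ∎))
      where open ≤-Reasoning

    cost-≤-of-far : ∀ {c c′} n → c + 2 * k < c′ → c′ ≤ 2 * k * n → cost c ≤ n
    cost-≤-of-far {c} {c′} zero    far c′≤0 = contradiction (<-≤-trans far (≤-trans c′≤0 (≤-reflexive (*-zeroʳ (2 * k))))) n≮0
    cost-≤-of-far {c} {c′} (suc n) far c′≤2k[1+n] = cost-≤-suc n (<⇒≤ (+-cancelʳ-< (2 * k) c (2 * k * n) (begin-strict
      c + 2 * k           <⟨ far ⟩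
      c′                  ≤⟨ c′≤2k[1+n] ⟩
      2 * k * suc n       ≡⟨ trans (*-suc (2 * k) n) (+-comm (2 * k) _) ⟩
      2 * k * n + 2 * k   ∎)))
      where open ≤-Reasoning

    weight≤2k*count : ∀ x₀ {T W} → W ≤ k * T → x₀ + 2 * W ≤ 2 * k * (x₀ + T)
    weight≤2k*count x₀ {T} {W} W≤kT = begin
      x₀ + 2 * W               ≤⟨ +-mono-≤ (m≤n*m x₀ (2 * k)) (*-monoʳ-≤ 2 W≤kT) ⟩
      2 * k * x₀ + 2 * (k * T) ≡⟨ cong (2 * k * x₀ +_) (sym (*-assoc 2 k T)) ⟩
      2 * k * x₀ + 2 * k * T   ≡⟨ sym (*-distribˡ-+ (2 * k) x₀ T) ⟩
      2 * k * (x₀ + T)         ∎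
      where open ≤-Reasoning

  module AperySet (a h d k′ : ℕ) where

    open Cost k′

    A : Vec ℕ (suc k)
    A = gens a h d k

    L : ℕ
    L = h * a + 2 * k * d

    apery : ℕ → ℕ
    apery c = cost c * (h * a) + d * c

    apery-via-parity : ∀ {c} e q {m} → c ≡ e + q * 2 → e < 2 → ⌈ q /k⌉ ≡ m →
      apery c ≡ (e + m) * (h * a) + d * (e + q * 2)
    apery-via-parity e q refl e<2 refl = cong (λ m → m * (h * a) + d * (e + q * 2)) (cost-parity q e<2)

    representable-generator : ∀ {l} → l < k → Representable A (h * a + 2 * suc l * d)
    representable-generator {l} l<k = subst (Representable A)
      (trans (lookup∘tabulate generator (fsuc (fromℕ< l<k))) (cong (λ i → h * a + 2 * suc i * d) (toℕ-fromℕ< l<k)))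
      (representable-lookup A (fsuc (fromℕ< l<k)))
      where
      generator : Fin (suc k) → ℕ
      generator fzero    = h * a + d
      generator (fsuc i) = h * a + 2 * suc (toℕ i) * d

    representable-apery : ∀ c → Representable A (apery c)
    representable-apery c with c divMod 2
    ... | result zero e refl = subst (Representable A)
          (trans (expand (toℕ e) (h * a) d) (sym (apery-via-parity (toℕ e) 0 refl (toℕ<n e) (⌈j*k/k⌉ 0))))
          (representable-* A (toℕ e) (representable-lookup A fzero))
      where
      expand : ∀ e H d → e * (H + d) ≡ (e + 0) * H + d * (e + 0 * 2)
      expand = solve-∀
    ... | result (suc q) e refl with q divMod k
    ...   | result j r refl = subst (Representable A)
          (trans (expand (toℕ e) (h * a) d (toℕ r) j k′)
                 (sym (apery-via-parity (toℕ e) (suc (toℕ r + j * k)) refl (toℕ<n e) (⌈1+r+j*k/k⌉ j (toℕ<n r)))))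
          (representable-+ A (representable-* A (toℕ e) (representable-lookup A fzero))
            (representable-+ A (representable-generator (toℕ<n r)) (representable-* A j (representable-generator (n<1+n k′)))))
      where
      expand : ∀ e H d r j k′ → e * (H + d) + ((H + 2 * suc r * d) + j * (H + 2 * suc k′ * d))
                              ≡ (e + suc j) * H + d * (e + suc (r + j * suc k′) * 2)
      expand = solve-∀

    representation-shape : ∀ xs → ∃₂ λ x₀ T → ∃ λ W → W ≤ k * T × dot A xs ≡ (x₀ + T) * (h * a) + d * (x₀ + 2 * W)
    representation-shape (x₀ ∷ ys) with tabulate-shape (h * a) d k (λ i → suc (toℕ i)) toℕ<n ys
    ... | T , W , W≤kT , dot≡ = x₀ , T , W , W≤kT ,
          trans (cong ((h * a + d) * x₀ +_) dot≡) (regroup (h * a) d x₀ T W)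
      where
      regroup : ∀ H d x₀ T W → (H + d) * x₀ + (T * H + d * (2 * W)) ≡ (x₀ + T) * H + d * (x₀ + 2 * W)
      regroup = solve-∀

    apery-zero : apery 0 ≡ 0
    apery-zero = cong₂ (λ m n → m * (h * a) + n) (⌈j*k/k⌉ 0) (*-zeroʳ d)

    apery-first : ∀ j → apery (suc (2 * k * j + 0)) ≡ (h * a + d) + L * j
    apery-first j = trans (apery-via-parity 1 (j * k) (split k′ j) (s≤s (s≤s z≤n)) (⌈j*k/k⌉ j)) (collect h a d k′ j)
      where
      split : ∀ k′ j → suc (2 * suc k′ * j + 0) ≡ 1 + j * suc k′ * 2
      split = solve-∀
      collect : ∀ h a d k′ j → (1 + j) * (h * a) + d * (1 + j * suc k′ * 2) ≡ (h * a + d) + (h * a + 2 * suc k′ * d) * j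
      collect = solve-∀

    apery-odd : ∀ j {l} → l < k → apery (suc (2 * k * j + suc (2 * l))) ≡ (h * a + 2 * d) + L * j + 2 * d * l
    apery-odd j {l} l<k = trans (apery-via-parity 0 (suc (l + j * k)) (split k′ j l) (s≤s z≤n) (⌈1+r+j*k/k⌉ j l<k)) (collect h a d k′ j l)
      where
      split : ∀ k′ j l → suc (2 * suc k′ * j + suc (2 * l)) ≡ 0 + suc (l + j * suc k′) * 2
      split = solve-∀
      collect : ∀ h a d k′ j l → (0 + suc j) * (h * a) + d * (0 + suc (l + j * suc k′) * 2)
                                ≡ (h * a + 2 * d) + (h * a + 2 * suc k′ * d) * j + 2 * d * l
      collect = solve-∀

    apery-even : ∀ j {l} → l < k → apery (suc (2 * k * j + suc (suc (2 * l)))) ≡ (2 * h * a + 3 * d) + L * j + 2 * d * l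
    apery-even j {l} l<k = trans (apery-via-parity 1 (suc (l + j * k)) (split k′ j l) (s≤s (s≤s z≤n)) (⌈1+r+j*k/k⌉ j l<k)) (collect h a d k′ j l)
      where
      split : ∀ k′ j l → suc (2 * suc k′ * j + suc (suc (2 * l))) ≡ 1 + suc (l + j * suc k′) * 2
      split = solve-∀
      collect : ∀ h a d k′ j l → (1 + suc j) * (h * a) + d * (1 + suc (l + j * suc k′) * 2)
                                ≡ (2 * h * a + 3 * d) + (h * a + 2 * suc k′ * d) * j + 2 * d * l
      collect = solve-∀

    module _ .{{_ : NonZero a}} where

      [m*ha+d*w]%a≡[d*w]%a : ∀ m w → (m * (h * a) + d * w) % a ≡ (d * w) % a
      [m*ha+d*w]%a≡[d*w]%a m w = trans (cong (_% a) (regroup m h a d w)) ([m+kn]%n≡m%n (d * w) (m * h) a)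
        where
        regroup : ∀ m h a d w → m * (h * a) + d * w ≡ d * w + (m * h) * a
        regroup = solve-∀

      apery-congruent : ∀ c → CongMod a (apery c) ((d * c) % a)
      apery-congruent c = apery c / a , (begin
        apery c                              ≡⟨ m≡m%n+[m/n]*n (apery c) a ⟩
        apery c % a + apery c / a * a        ≡⟨ cong (_+ apery c / a * a) ([m*ha+d*w]%a≡[d*w]%a (cost c) c) ⟩
        (d * c) % a + apery c / a * a        ≡⟨ +-comm ((d * c) % a) _ ⟩
        apery c / a * a + (d * c) % a        ∎)
        where open ≡-Reasoning

      module _ {e} (de≡1 : (d * e) % a ≡ 1) (2k<a : 2 * k < a) where

        open MultiplicationMod a {d} de≡1 using (*-cancelˡ-≡-mod)

        apery-least : ∀ {c} → c < a → ∀ n′ → CongMod a n′ ((d * c) % a) → Representable A n′ → apery c ≤ n′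
        apery-least {c} c<a n′ (q , n′≡) (xs , refl) with representation-shape xs
        ... | x₀ , T , W , W≤kT , dot≡ = begin
          cost c * (h * a) + d * c              ≤⟨ +-mono-≤ (*-monoˡ-≤ (h * a) (proj₁ bounds)) (*-monoʳ-≤ d (proj₂ bounds)) ⟩
          (x₀ + T) * (h * a) + d * (x₀ + 2 * W) ≡⟨ dot≡ ⟨
          dot A xs                              ∎
          where
          open ≤-Reasoning
          c′ = x₀ + 2 * W
          dc′≡dc : (d * c′) % a ≡ (d * c) % a
          dc′≡dc = begin-equality
            (d * c′) % a                          ≡⟨ [m*ha+d*w]%a≡[d*w]%a (x₀ + T) c′ ⟨
            ((x₀ + T) * (h * a) + d * c′) % a     ≡⟨ cong (_% a) (trans (sym dot≡) n′≡) ⟩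
            (q * a + (d * c) % a) % a             ≡⟨ cong (_% a) (+-comm (q * a) _) ⟩
            ((d * c) % a + q * a) % a             ≡⟨ [m+kn]%n≡m%n ((d * c) % a) q a ⟩
            (d * c) % a % a                       ≡⟨ m%n%n≡m%n (d * c) a ⟩
            (d * c) % a                           ∎
          c′%a≡c : c′ % a ≡ c
          c′%a≡c = trans (*-cancelˡ-≡-mod c′ c dc′≡dc) (m<n⇒m%n≡m c<a)
          bounds : cost c ≤ x₀ + T × c ≤ c′
          bounds with ≡-mod⇒≡⊎+≤ c<a c′%a≡c
          ... | inj₁ c′≡c   = subst (λ v → cost v ≤ x₀ + T) c′≡c (cost-≤ x₀ W≤kT) , ≤-reflexive (sym c′≡c)
          ... | inj₂ c+a≤c′ = cost-≤-of-far (x₀ + T) (≤-trans (+-monoʳ-< c 2k<a) c+a≤c′) (weight≤2k*count x₀ W≤kT)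
                            , ≤-trans (m≤m+n c a) c+a≤c′

        apery-isN : ∀ {c} → c < a → IsN a A ((d * c) % a) (apery c)
        apery-isN {c} c<a = apery-congruent c , representable-apery c , apery-least c<a

module GeneratingFunction (a h d k′ : ℕ) (x : ℚ) where

  open import Data.Nat as ℕ using (ℕ; suc; s≤s; z≤n)
  import Data.Nat.Properties as ℕ
  open import Data.Nat.Tactic.RingSolver using (solve-∀)
  open import Data.Rational using (ℚ; 0ℚ; 1ℚ; _+_; _*_; _-_)
  open import Data.Sum using (inj₁; inj₂)
  open import Data.Product using (_,_)
  open import Data.Rational.Properties using (+-assoc; *-comm)
  open import Data.Rational.Solver using (module +-*-Solver)
  open +-*-Solver
  open import Relation.Binary.PropositionalEquality
  open import Defs using (_^_; _÷_; f₁; rhs)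
  open RationalSums
  open NumericalSemigroups.Cost k′ using (k)
  open NumericalSemigroups.AperySet a h d k′ using (L; apery; apery-zero; apery-first; apery-odd; apery-even)
  open ≡-Reasoning

  y z P Q R : ℚ
  y = x ^ L
  z = x ^ (2 ℕ.* d)
  P = x ^ (h ℕ.* a ℕ.+ d)
  Q = x ^ (h ℕ.* a ℕ.+ 2 ℕ.* d)
  R = x ^ (2 ℕ.* h ℕ.* a ℕ.+ 3 ℕ.* d)

  ^-affine : ∀ e j l → x ^ (e ℕ.+ L ℕ.* j ℕ.+ 2 ℕ.* d ℕ.* l) ≡ x ^ e * y ^ j * z ^ l
  ^-affine e j l = begin
    x ^ (e ℕ.+ L ℕ.* j ℕ.+ 2 ℕ.* d ℕ.* l)          ≡⟨ ^-homo-+ x (e ℕ.+ L ℕ.* j) _ ⟩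
    x ^ (e ℕ.+ L ℕ.* j) * x ^ (2 ℕ.* d ℕ.* l)      ≡⟨ cong₂ _*_ (^-homo-+ x e (L ℕ.* j)) (^-* x (2 ℕ.* d) l) ⟩
    x ^ e * x ^ (L ℕ.* j) * z ^ l                  ≡⟨ cong (λ v → x ^ e * v * z ^ l) (^-* x L j) ⟩
    x ^ e * y ^ j * z ^ l                          ∎

  term : ℕ → ℕ → ℚ
  term j i = x ^ apery (suc (2 ℕ.* k ℕ.* j ℕ.+ i))

  term-first : ∀ j → term j 0 ≡ y ^ j * P
  term-first j = begin
    x ^ apery (suc (2 ℕ.* k ℕ.* j ℕ.+ 0))   ≡⟨ cong (x ^_) (apery-first j) ⟩
    x ^ (h ℕ.* a ℕ.+ d ℕ.+ L ℕ.* j)         ≡⟨ ^-homo-+ x (h ℕ.* a ℕ.+ d) (L ℕ.* j) ⟩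
    P * x ^ (L ℕ.* j)                       ≡⟨ cong (P *_) (^-* x L j) ⟩
    P * y ^ j                               ≡⟨ *-comm P (y ^ j) ⟩
    y ^ j * P                               ∎

  term-odd : ∀ j {l} → l ℕ.< k → term j (suc (2 ℕ.* l)) ≡ y ^ j * (Q * z ^ l)
  term-odd j {l} l<k = trans (cong (x ^_) (apery-odd j l<k))
    (trans (^-affine (h ℕ.* a ℕ.+ 2 ℕ.* d) j l) (solve 3 (λ Q Y Z → Q :* Y :* Z := Y :* (Q :* Z)) refl Q (y ^ j) (z ^ l)))

  term-even : ∀ j {l} → l ℕ.< k → term j (suc (suc (2 ℕ.* l))) ≡ y ^ j * (R * z ^ l)
  term-even j {l} l<k = trans (cong (x ^_) (apery-even j l<k))
    (trans (^-affine (2 ℕ.* h ℕ.* a ℕ.+ 3 ℕ.* d) j l) (solve 3 (λ R Y Z → R :* Y :* Z := Y :* (R :* Z)) refl R (y ^ j) (z ^ l)))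

  block : ℕ → ℕ → ℚ
  block u v = P + Q * geometric z u + R * geometric z v

  ∑-y^j*[D*z^l] : ∀ j D u → ∑ u (λ l → y ^ j * (D * z ^ l)) ≡ y ^ j * (D * geometric z u)
  ∑-y^j*[D*z^l] j D u = sym (trans (cong (y ^ j *_) (*-distribˡ-∑ D u (z ^_))) (*-distribˡ-∑ (y ^ j) u _))

  block-odd : ∀ j u → suc (2 ℕ.* u) ℕ.≤ 2 ℕ.* k → ∑ (suc (2 ℕ.* u)) (term j) ≡ y ^ j * block u u
  block-odd j u 2u<2k = begin
    term j 0 + ∑ (2 ℕ.* u) (λ i → term j (suc i))
      ≡⟨ cong (term j 0 +_) (∑-interleave u (λ i → term j (suc i))) ⟩
    term j 0 + (∑ u (λ l → term j (suc (2 ℕ.* l))) + ∑ u (λ l → term j (suc (suc (2 ℕ.* l)))))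
      ≡⟨ cong₂ (λ v w → v + (w + ∑ u (λ l → term j (suc (suc (2 ℕ.* l))))))
               (term-first j) (∑-cong u (λ l l<u → term-odd j (l<k l<u))) ⟩
    y ^ j * P + (∑ u (λ l → y ^ j * (Q * z ^ l)) + ∑ u (λ l → term j (suc (suc (2 ℕ.* l)))))
      ≡⟨ cong₂ (λ v w → y ^ j * P + (v + w))
               (∑-y^j*[D*z^l] j Q u) (trans (∑-cong u (λ l l<u → term-even j (l<k l<u))) (∑-y^j*[D*z^l] j R u)) ⟩
    y ^ j * P + (y ^ j * (Q * geometric z u) + y ^ j * (R * geometric z u))
      ≡⟨ solve 5 (λ Y P Q R G → Y :* P :+ (Y :* (Q :* G) :+ Y :* (R :* G)) := Y :* (P :+ Q :* G :+ R :* G))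
               refl (y ^ j) P Q R (geometric z u) ⟩
    y ^ j * block u u ∎
    where
    l<k : ∀ {l} → l ℕ.< u → l ℕ.< k
    l<k l<u = ℕ.<-≤-trans l<u (ℕ.*-cancelˡ-≤ 2 (ℕ.<⇒≤ 2u<2k))

  block-even : ∀ j u → 2 ℕ.* suc u ℕ.≤ 2 ℕ.* k → ∑ (2 ℕ.* suc u) (term j) ≡ y ^ j * block (suc u) u
  block-even j u 2u+2≤2k = begin
    ∑ (2 ℕ.* suc u) (term j)                          ≡⟨ cong (λ n → ∑ n (term j)) (ℕ.*-suc 2 u) ⟩
    ∑ (suc (suc (2 ℕ.* u))) (term j)                  ≡⟨ ∑-suc (suc (2 ℕ.* u)) (term j) ⟩
    ∑ (suc (2 ℕ.* u)) (term j) + term j (suc (2 ℕ.* u))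
      ≡⟨ cong₂ _+_ (block-odd j u (ℕ.<⇒≤ 2u+1<2k)) (term-odd j (ℕ.*-cancelˡ-< 2 u k (ℕ.<-trans (ℕ.n<1+n _) 2u+1<2k))) ⟩
    y ^ j * block u u + y ^ j * (Q * z ^ u)
      ≡⟨ solve 6 (λ Y P Q R G Z → Y :* (P :+ Q :* G :+ R :* G) :+ Y :* (Q :* Z) := Y :* (P :+ Q :* (G :+ Z) :+ R :* G))
               refl (y ^ j) P Q R (geometric z u) (z ^ u) ⟩
    y ^ j * (P + Q * (geometric z u + z ^ u) + R * geometric z u)
      ≡⟨ cong (λ g → y ^ j * (P + Q * g + R * geometric z u)) (sym (geometric-suc z u)) ⟩
    y ^ j * block (suc u) u ∎
    where
    2u+1<2k : suc (2 ℕ.* u) ℕ.< 2 ℕ.* k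
    2u+1<2k = ℕ.≤-trans (ℕ.≤-reflexive (sym (ℕ.*-suc 2 u))) 2u+2≤2k

  ∑-apery≡blocks : ∀ s t → a ≡ suc (2 ℕ.* k ℕ.* s ℕ.+ t) →
    ∑ a (λ c → x ^ apery c) ≡ 1ℚ + geometric y s * block k k′ + ∑ t (term s)
  ∑-apery≡blocks s t a≡ = begin
    ∑ a (λ c → x ^ apery c)                                   ≡⟨ cong (λ n → ∑ n (λ c → x ^ apery c)) a≡ ⟩
    x ^ apery 0 + ∑ (2 ℕ.* k ℕ.* s ℕ.+ t) (λ c → x ^ apery (suc c))
      ≡⟨ cong₂ _+_ (cong (x ^_) apery-zero) (∑-+ (2 ℕ.* k ℕ.* s) t _) ⟩
    1ℚ + (∑ (2 ℕ.* k ℕ.* s) (λ c → x ^ apery (suc c)) + ∑ t (term s))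
      ≡⟨ cong (λ v → 1ℚ + (v + ∑ t (term s)))
              (trans (∑-* (2 ℕ.* k) s _) (∑-cong s (λ j _ → block-even j k′ ℕ.≤-refl))) ⟩
    1ℚ + (∑ s (λ j → y ^ j * block k k′) + ∑ t (term s))
      ≡⟨ cong (λ v → 1ℚ + (v + ∑ t (term s))) (sym (*-distribʳ-∑ (block k k′) s (y ^_))) ⟩
    1ℚ + (geometric y s * block k k′ + ∑ t (term s))          ≡⟨ sym (+-assoc 1ℚ (geometric y s * block k k′) (∑ t (term s))) ⟩
    1ℚ + geometric y s * block k k′ + ∑ t (term s)            ∎

  module _ (s : ℕ) (1-y≢0 : 1ℚ - y ≢ 0ℚ) (1-z≢0 : 1ℚ - z ≢ 0ℚ) where

    private
      x^[e+L*s]≡ : ∀ e {n} → n ≡ e ℕ.+ L ℕ.* s → x ^ n ≡ x ^ e * y ^ s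
      x^[e+L*s]≡ e refl = trans (^-homo-+ x e (L ℕ.* s)) (cong (x ^ e *_) (^-* x L s))

      ÷[1-z] : ∀ X {n} u → n ≡ 2 ℕ.* d ℕ.* u → (X * (1ℚ - x ^ n)) ÷ (1ℚ - z) ≡ X * geometric z u
      ÷[1-z] X u refl = trans (cong (λ v → (X * (1ℚ - v)) ÷ (1ℚ - z)) (^-* x (2 ℕ.* d) u)) (*[1-y^n]÷[1-y] X z u 1-z≢0)

      X₁ X₂ : ℚ
      X₁ = x ^ (h ℕ.* a ℕ.* (s ℕ.+ 1) ℕ.+ d ℕ.* (2 ℕ.* k ℕ.* s ℕ.+ 2))
      X₂ = x ^ (h ℕ.* a ℕ.* (s ℕ.+ 2) ℕ.+ d ℕ.* (2 ℕ.* k ℕ.* s ℕ.+ 3))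

      X₁≡ : X₁ ≡ Q * y ^ s
      X₁≡ = x^[e+L*s]≡ (h ℕ.* a ℕ.+ 2 ℕ.* d) (regroup h a d k s)
        where
        regroup : ∀ h a d k s → h ℕ.* a ℕ.* (s ℕ.+ 1) ℕ.+ d ℕ.* (2 ℕ.* k ℕ.* s ℕ.+ 2)
                              ≡ (h ℕ.* a ℕ.+ 2 ℕ.* d) ℕ.+ (h ℕ.* a ℕ.+ 2 ℕ.* k ℕ.* d) ℕ.* s
        regroup = solve-∀

      X₂≡ : X₂ ≡ R * y ^ s
      X₂≡ = x^[e+L*s]≡ (2 ℕ.* h ℕ.* a ℕ.+ 3 ℕ.* d) (regroup h a d k s)
        where
        regroup : ∀ h a d k s → h ℕ.* a ℕ.* (s ℕ.+ 2) ℕ.+ d ℕ.* (2 ℕ.* k ℕ.* s ℕ.+ 3)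
                              ≡ (2 ℕ.* h ℕ.* a ℕ.+ 3 ℕ.* d) ℕ.+ (h ℕ.* a ℕ.+ 2 ℕ.* k ℕ.* d) ℕ.* s
        regroup = solve-∀

      [1+2u]%2≡1 : ∀ u → suc (2 ℕ.* u) ℕ.% 2 ≡ 1
      [1+2u]%2≡1 u = trans (cong (λ n → suc n ℕ.% 2) (ℕ.*-comm 2 u)) (NumericalSemigroups.[r+j*n]%n≡r u 2 (s≤s (s≤s z≤n)))

      [2+2u]%2≡0 : ∀ u → (2 ℕ.* suc u) ℕ.% 2 ≡ 0
      [2+2u]%2≡0 u = trans (cong (ℕ._% 2) (ℕ.*-comm 2 (suc u))) (NumericalSemigroups.[r+j*n]%n≡r (suc u) 2 (s≤s z≤n))

      d*2u≡2d*u : ∀ u → d ℕ.* (2 ℕ.* u) ≡ 2 ℕ.* d ℕ.* u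
      d*2u≡2d*u u = trans (sym (ℕ.*-assoc d 2 u)) (cong (ℕ._* u) (ℕ.*-comm d 2))

    f₁-odd : ∀ u → f₁ a h d k s (suc (2 ℕ.* u)) x ≡ Q * y ^ s * geometric z u + R * y ^ s * geometric z u
    f₁-odd u rewrite [1+2u]%2≡1 u = cong₂ _+_
      (trans (÷[1-z] X₁ u (d*2u≡2d*u u)) (cong (_* geometric z u) X₁≡))
      (trans (÷[1-z] X₂ u (d*2u≡2d*u u)) (cong (_* geometric z u) X₂≡))

    f₁-even : ∀ u → f₁ a h d k s (2 ℕ.* suc u) x ≡ Q * y ^ s * geometric z (suc u) + R * y ^ s * geometric z u
    f₁-even u rewrite [2+2u]%2≡0 u = cong₂ _+_
      (trans (÷[1-z] X₁ (suc u) (d*2u≡2d*u (suc u))) (cong (_* geometric z (suc u)) X₁≡))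
      (trans (÷[1-z] X₂ u (trans (cong (λ n → d ℕ.* (n ℕ.∸ 2)) (ℕ.*-suc 2 u)) (d*2u≡2d*u u))) (cong (_* geometric z u) X₂≡))

    rhs-≡ : ∀ t → rhs a h d k s t x ≡ 1ℚ + P * geometric y (suc s) + Q * geometric y s * geometric z k
                                        + R * geometric y s * geometric z k′ + f₁ a h d k s t x
    rhs-≡ t = cong (_+ f₁ a h d k s t x) (cong₂ _+_ (cong₂ _+_ (cong (1ℚ +_) first) (second {Q} k)) (second {R} k′))
      where
      first : (P * (1ℚ - x ^ (L ℕ.* (s ℕ.+ 1)))) ÷ (1ℚ - x ^ L) ≡ P * geometric y (suc s)
      first = begin
        (P * (1ℚ - x ^ (L ℕ.* (s ℕ.+ 1)))) ÷ (1ℚ - y) ≡⟨ cong (λ v → (P * (1ℚ - v)) ÷ (1ℚ - y)) (^-* x L (s ℕ.+ 1)) ⟩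
        (P * (1ℚ - y ^ (s ℕ.+ 1))) ÷ (1ℚ - y)         ≡⟨ *[1-y^n]÷[1-y] P y (s ℕ.+ 1) 1-y≢0 ⟩
        P * geometric y (s ℕ.+ 1)                     ≡⟨ cong (λ n → P * geometric y n) (ℕ.+-comm s 1) ⟩
        P * geometric y (suc s)                       ∎
      second : ∀ {X} n → (X * (1ℚ - x ^ (L ℕ.* s)) * (1ℚ - x ^ (2 ℕ.* d ℕ.* n))) ÷ ((1ℚ - y) * (1ℚ - z))
                         ≡ X * geometric y s * geometric z n
      second {X} n = trans (cong₂ (λ v w → (X * (1ℚ - v) * (1ℚ - w)) ÷ ((1ℚ - y) * (1ℚ - z))) (^-* x L s) (^-* x (2 ℕ.* d) n))
                           (*[1-y^m][1-z^n]÷[1-y][1-z] X y z s n 1-y≢0 1-z≢0)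

    ∑-apery≡rhs-of-tail : ∀ t {u v} → a ≡ suc (2 ℕ.* k ℕ.* s ℕ.+ t) → ∑ t (term s) ≡ y ^ s * block u v →
      f₁ a h d k s t x ≡ Q * y ^ s * geometric z u + R * y ^ s * geometric z v →
      ∑ a (λ c → x ^ apery c) ≡ rhs a h d k s t x
    ∑-apery≡rhs-of-tail t {u} {v} a≡ tail≡ f₁≡ = begin
      ∑ a (λ c → x ^ apery c)                                  ≡⟨ ∑-apery≡blocks s t a≡ ⟩
      1ℚ + geometric y s * block k k′ + ∑ t (term s)           ≡⟨ cong (1ℚ + geometric y s * block k k′ +_) tail≡ ⟩
      1ℚ + geometric y s * block k k′ + y ^ s * block u v
        ≡⟨ solve 9 (λ P Q R Gy Gk Gk′ Y Gu Gv →
             con 1ℚ :+ Gy :* (P :+ Q :* Gk :+ R :* Gk′) :+ Y :* (P :+ Q :* Gu :+ R :* Gv)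
             := con 1ℚ :+ P :* (Gy :+ Y) :+ Q :* Gy :* Gk :+ R :* Gy :* Gk′ :+ (Q :* Y :* Gu :+ R :* Y :* Gv))
           refl P Q R (geometric y s) (geometric z k) (geometric z k′) (y ^ s) (geometric z u) (geometric z v) ⟩
      1ℚ + P * (geometric y s + y ^ s) + Q * geometric y s * geometric z k + R * geometric y s * geometric z k′
        + (Q * y ^ s * geometric z u + R * y ^ s * geometric z v)
        ≡⟨ cong₂ (λ g f → 1ℚ + P * g + Q * geometric y s * geometric z k + R * geometric y s * geometric z k′ + f)
                 (sym (geometric-suc y s)) (sym f₁≡) ⟩
      1ℚ + P * geometric y (suc s) + Q * geometric y s * geometric z k + R * geometric y s * geometric z k′
        + f₁ a h d k s t x                                     ≡⟨ rhs-≡ t ⟨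
      rhs a h d k s t x                                        ∎

    ∑-apery≡rhs : ∀ t → a ≡ suc (2 ℕ.* k ℕ.* s ℕ.+ t) → 1 ℕ.≤ t → t ℕ.≤ 2 ℕ.* k →
      ∑ a (λ c → x ^ apery c) ≡ rhs a h d k s t x
    ∑-apery≡rhs t a≡ 1≤t t≤2k with NumericalSemigroups.odd⊎even 1≤t
    ... | inj₁ (u , refl) = ∑-apery≡rhs-of-tail t {u} {u} a≡ (block-odd s u t≤2k) (f₁-odd u)
    ... | inj₂ (u , refl) = ∑-apery≡rhs-of-tail t {suc u} {u} a≡ (block-even s u t≤2k) (f₁-even u)

open import Defs
open import Data.Nat using (ℕ; suc; _+_; _*_; _∸_; _≤_; _>_; s≤s; z≤n)
open import Data.Nat.Properties using (≤-trans; m≤n+m)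
open import Data.Nat.GCD using (gcd)
open import Data.Fin using (Fin; toℕ)
open import Data.Fin.Properties using (toℕ<n)
open import Data.Fin.Permutation using (_⟨$⟩ʳ_)
open import Data.Rational using (ℚ; 1ℚ; -_)
open import Data.Product using (proj₁; proj₂)
open import Relation.Binary.PropositionalEquality using (_≡_; _≢_; cong; subst; module ≡-Reasoning)
open RationalSums using (∑; fSum-permute; 1-^≢0)
open NumericalSemigroups using (inverse-mod; IsN-unique; module MultiplicationMod; module AperySet)

propositionA6 : (a h d k : ℕ) → 1 ≤ h → 1 ≤ k → gcd a d ≡ 1 → a > 2 → d > h →
    1 ≤ 2 * k → 2 * k ≤ a ∸ 1 →
    (s t : ℕ) → a ∸ 1 ≡ 2 * k * s + t → 1 ≤ t → t ≤ 2 * k →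
    (N : Fin a → ℕ) → (∀ r → IsN a (gens a h d k) (toℕ r) (N r)) →
    (x : ℚ) → x ≢ 1ℚ → x ≢ - 1ℚ →
    fSum a N x ≡ rhs a h d k s t x
propositionA6 a@(suc (suc a₀)) h d@(suc d₀) k@(suc k′) _ _ gcd≡1 _ _ _ 2k≤a-1 s t a-1≡ 1≤t t≤2k N N-isN x x≢1 x≢-1 =
  begin
    fSum a N x                ≡⟨ fSum-permute multiplication N apery x N∘multiplication≗apery ⟩
    ∑ a (λ c → x ^ apery c)   ≡⟨ ∑-apery≡rhs s 1-y≢0 1-z≢0 t (cong suc a-1≡) 1≤t t≤2k ⟩
    rhs a h d k s t x         ∎
  where
  open ≡-Reasoning
  open AperySet a h d k′ using (A; L; apery; apery-isN)
  open GeneratingFunction a h d k′ x using (∑-apery≡rhs)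
  inverse = inverse-mod a₀ d gcd≡1
  de≡1 = proj₂ inverse
  open MultiplicationMod a {d} {proj₁ inverse} de≡1 using (multiplication; toℕ-multiplication)
  N∘multiplication≗apery : ∀ c → N (multiplication ⟨$⟩ʳ c) ≡ apery (toℕ c)
  N∘multiplication≗apery c = IsN-unique {bs = A}
    (subst (λ r → IsN a A r (N (multiplication ⟨$⟩ʳ c))) (toℕ-multiplication c) (N-isN (multiplication ⟨$⟩ʳ c)))
    (apery-isN {e = proj₁ inverse} de≡1 (s≤s 2k≤a-1) (toℕ<n c))
  1-y≢0 = 1-^≢0 L x≢1 x≢-1 (≤-trans (s≤s z≤n) (m≤n+m (2 * k * d) (h * a)))
  1-z≢0 = 1-^≢0 (2 * d) x≢1 x≢-1 (s≤s z≤n)
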